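{- Let $q,a,b,s\ge 1$ be integers and $Q=\{0,1,\dots,q\}$. (i) If $\mathcal{F}$ is a strong or weak $s$-sum $(a,b)$-system in $Q^{<\mathbb{N}}$, then for all $(\mathbf{x},\mathbf{y})\in\mathcal{F}$ and all coordinates $i$ we have $x_i<s$ and $y_i<s$. (ii) If $t>1$ is an integer and $\mathcal{F}\subset Q^{<\mathbb{N}}\times Q^{<\mathbb{N}}$ is a strong (respectively weak) $(q+t)$-sum $(a,b)$-system, then there exists a strong (respectively weak) $(q-t+2)$-sum $(a,b)$-system $\mathcal{F}'\subset(\{0,1,\dots,q-t+1\}^{<\mathbb{N}})^2$ with $|\mathcal{F}'|=|\mathcal{F}|$.
   Context: $Q^{<\mathbb{N}}$ denotes the set of infinite sequences with entries in $Q$ and finite support $S_{\mathbf{x}}=\{i:x_i\neq0\}$ (similarly for $\{0,\dots,q-t+1\}^{<\mathbb{N}}$). For $\mathbf{x},\mathbf{y}$ put $|\mathbf{x}\cap_s\mathbf{y}|=|\{i:x_i+y_i\ge s\}|$. A system $\{(\mathbf{x}^j,\mathbf{y}^j):j=1,\dots,m\}$ with $|\mathbf{x}^j\cap_s\mathbf{y}^j|=0$ for all $j$ is a strong $s$-sum IVP-system if $|\mathbf{x}^i\cap_s\mathbf{y}^j|\neq0$ for all $i\neq j$, and weak if for all $i\neq j$ at least one of $|\mathbf{x}^i\cap_s\mathbf{y}^j|$, $|\mathbf{x}^j\cap_s\mathbf{y}^i|$ is nonzero. It is an $(a,b)$-system if $|S_{\mathbf{x}^j}|\le a$ and $|S_{\mathbf{y}^j}|\le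 b$ for all $j$; its size is the number $m$ of pairs. -}

module Defs where

open import Data.Nat using (ℕ; zero; suc; _+_; _≤_; _≤ᵇ_; _≡ᵇ_; _⊔_)
open import Data.Bool using (Bool; true; false; not; if_then_else_)
open import Data.Fin using (Fin)
open import Data.Product using (_×_)
open import Data.Sum using (_⊎_)
open import Relation.Binary.PropositionalEquality using (_≡_; _≢_)

record FinSeq : Set where
  field
    seq    : ℕ → ℕ
    bound  : ℕ
    vanish : ∀ i → bound ≤ i → seq i ≡ 0
open FinSeq public

countBelow : (ℕ → Bool) → ℕ → ℕ
countBelow P zero    = 0
countBelow P (suc n) = (if P n then 1 else 0) + countBelow P n

InRange : ℕ → FinSeq → Set
InRange q x = ∀ i → seq x i ≤ q

-- |S_x| = |{ i : x_i ≠ 0 }|  (all such i lie below bound x)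
suppSize : FinSeq → ℕ
suppSize x = countBelow (λ i → not (seq x i ≡ᵇ 0)) (bound x)

-- |x ∩_s y| = |{ i : x_i + y_i ≥ s }|  (for s ≥ 1 all such i lie below the bounds)
capSize : ℕ → FinSeq → FinSeq → ℕ
capSize s x y = countBelow (λ i → s ≤ᵇ seq x i + seq y i) (bound x ⊔ bound y)

IsABSystem : (q s a b m : ℕ) → (Fin m → FinSeq) → (Fin m → FinSeq) → Set
IsABSystem q s a b m xs ys =
  ∀ j → InRange q (xs j) × InRange q (ys j)
      × suppSize (xs j) ≤ a × suppSize (ys j) ≤ b
      × capSize s (xs j) (ys j) ≡ 0

IsStrong : (s m : ℕ) → (Fin m → FinSeq) → (Fin m → FinSeq) → Set
IsStrong s m xs ys = ∀ i j → i ≢ j → capSize s (xs i) (ys j) ≢ 0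

IsWeak : (s m : ℕ) → (Fin m → FinSeq) → (Fin m → FinSeq) → Set
IsWeak s m xs ys = ∀ i j → i ≢ j →
  (capSize s (xs i) (ys j) ≢ 0) ⊎ (capSize s (xs j) (ys i) ≢ 0)

{-# OPTIONS --safe #-}
-- For entries in {0..q}
-- one has x + y ≥ q + t exactly when (x ∸ u) + (y ∸ u) ≥ (q ∸ t) + 2, so every
-- intersection size is preserved; entries drop into {0..(q ∸ t) + 1} and supports can only
-- shrink, so strong and weak systems of the same size are carried over.
module Submission where

open import Defs
open import Data.Nat using (ℕ; _+_; _∸_; _≤_; _<_; zero; suc; z≤n; s≤s; _≤ᵇ_; _≡ᵇ_; _⊔_; _<?_)
open import Data.Nat.Properties
open import Data.Fin using (Fin)
open import Data.Product using (_×_; ∃₂; _,_; proj₁; proj₂)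
open import Data.Sum using (_⊎_; inj₁; inj₂)
import Data.Sum as Sum
open import Data.Bool using (Bool; true; false; not; T; if_then_else_)
open import Data.Unit using (tt)
open import Data.Empty using (⊥-elim)
open import Function using (_∘_)
open import Function.Bundles using (_⇔_; mk⇔; Equivalence)
open import Relation.Nullary using (yes; no; ¬_)
open import Relation.Nullary.Reflects using (fromEquivalence; det)
open import Relation.Binary.PropositionalEquality

open Equivalence using (to; from)

countBelow-cong : ∀ {P R : ℕ → Bool} n → (∀ k → P k ≡ R k) → countBelow P n ≡ countBelow R n
countBelow-cong zero    P≡R = refl
countBelow-cong (suc n) P≡R =
  cong₂ _+_ (cong (λ b → if b then 1 else 0) (P≡R n)) (countBelow-cong n P≡R)

countBelow-mono : ∀ {P R : ℕ → Bool} n → (∀ k → T (P k) → T (R k)) → countBelow P n ≤ countBelow R n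
countBelow-mono {P} {R} zero    P⇒R = z≤n
countBelow-mono {P} {R} (suc n) P⇒R with P n in Pn | R n in Rn
... | false | false = countBelow-mono n P⇒R
... | false | true  = m≤n⇒m≤1+n (countBelow-mono n P⇒R)
... | true  | true  = s≤s (countBelow-mono n P⇒R)
... | true  | false = ⊥-elim (subst T Rn (P⇒R n (subst T (sym Pn) tt)))

countBelow≡0⇒false : ∀ {P : ℕ → Bool} n → countBelow P n ≡ 0 → ∀ {k} → k < n → P k ≡ false
countBelow≡0⇒false {P} (suc n) count≡0 (s≤s k≤n) with P n in Pn
... | false with m≤n⇒m<n∨m≡n k≤n
...   | inj₁ k<n  = countBelow≡0⇒false n count≡0 k<n
...   | inj₂ refl = Pn

≤ᵇ-cong : ∀ {m n o p} → (m ≤ n ⇔ o ≤ p) → (m ≤ᵇ n) ≡ (o ≤ᵇ p)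
≤ᵇ-cong {m} {n} {o} {p} m≤n⇔o≤p =
  det (≤ᵇ-reflects-≤ m n)
      (fromEquivalence (λ o≤ᵇp → from m≤n⇔o≤p (≤ᵇ⇒≤ o p o≤ᵇp)) (λ m≤n → ≤⇒≤ᵇ (to m≤n⇔o≤p m≤n)))

m∸n≤m∸[1+n]+1 : ∀ m n → m ∸ n ≤ m ∸ suc n + 1
m∸n≤m∸[1+n]+1 zero    n       rewrite 0∸n≡0 n = z≤n
m∸n≤m∸[1+n]+1 (suc m) zero    = ≤-reflexive (+-comm 1 m)
m∸n≤m∸[1+n]+1 (suc m) (suc n) = m∸n≤m∸[1+n]+1 m n

∸-below-threshold : ∀ {q u y} → y ≤ suc q → ¬ (q ∸ suc u + 2 ≤ y ∸ suc u)
∸-below-threshold {q} {u} {y} y≤1+q threshold≤y∸1+u =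
  <⇒≱ (+-monoʳ-< (q ∸ suc u) (n<1+n 1))
      (≤-trans threshold≤y∸1+u (≤-trans (∸-monoˡ-≤ (suc u) y≤1+q) (m∸n≤m∸[1+n]+1 q u)))

sum-exceeds-threshold⇔ : ∀ u {q x y} → x ≤ q → y ≤ q →
  (q + suc u ≤ x + y) ⇔ (q ∸ suc u + 2 ≤ (x ∸ u) + (y ∸ u))
sum-exceeds-threshold⇔ zero    {zero}  z≤n z≤n = mk⇔ (λ ()) (λ ())
sum-exceeds-threshold⇔ zero    {suc q} _ _ rewrite +-suc q 1 = mk⇔ (λ h → h) (λ h → h)
sum-exceeds-threshold⇔ (suc u) {zero}  z≤n z≤n = mk⇔ (λ ()) (λ ())
sum-exceeds-threshold⇔ (suc u) {suc q} {zero} {y} _ y≤q =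
  mk⇔ (λ h → ⊥-elim (m+1+n≰m (suc q) (≤-trans h y≤q))) (λ h → ⊥-elim (∸-below-threshold y≤q h))
sum-exceeds-threshold⇔ (suc u) {suc q} {suc x} {zero} x≤q _
  = mk⇔ (λ h → ⊥-elim (m+1+n≰m (suc q) (≤-trans (dropZero h) x≤q)))
        (λ h → ⊥-elim (∸-below-threshold {y = suc x} x≤q (dropZero h)))
  where
  dropZero : ∀ {n z} → n ≤ z + 0 → n ≤ z
  dropZero {z = z} = subst (_ ≤_) (+-identityʳ z)
sum-exceeds-threshold⇔ (suc u) {suc q} {suc x} {suc y} (s≤s x≤q) (s≤s y≤q)
  rewrite +-suc q (suc u) | +-suc x y =
  mk⇔ (λ h → to smaller (≤-pred (≤-pred h))) (λ h → s≤s (s≤s (from smaller h)))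
  where smaller = sum-exceeds-threshold⇔ u x≤q y≤q

shiftDown : ℕ → FinSeq → FinSeq
shiftDown u x = record
  { seq    = λ i → seq x i ∸ u
  ; bound  = bound x
  ; vanish = λ i bound≤i → trans (cong (_∸ u) (vanish x i bound≤i)) (0∸n≡0 u)
  }

InRange-shiftDown : ∀ u {q} x → InRange q x → InRange (q ∸ suc u + 1) (shiftDown u x)
InRange-shiftDown u {q} x x≤q i = ≤-trans (∸-monoˡ-≤ u (x≤q i)) (m∸n≤m∸[1+n]+1 q u)

suppSize-shiftDown : ∀ u x → suppSize (shiftDown u x) ≤ suppSize x
suppSize-shiftDown u x = countBelow-mono (bound x) nonzero
  where
  nonzero : ∀ k → T (not ((seq x k ∸ u) ≡ᵇ 0)) → T (not (seq x k ≡ᵇ 0))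
  nonzero k h with seq x k
  ... | suc _ = tt
  ... | zero rewrite 0∸n≡0 u = h

capSize-shiftDown : ∀ u {q} x y → InRange q x → InRange q y →
  capSize (q ∸ suc u + 2) (shiftDown u x) (shiftDown u y) ≡ capSize (q + suc u) x y
capSize-shiftDown u x y x≤q y≤q =
  countBelow-cong (bound x ⊔ bound y) λ i → sym (≤ᵇ-cong (sum-exceeds-threshold⇔ u (x≤q i) (y≤q i)))

module ShiftDown {q a b m : ℕ} (u : ℕ) (xs ys : Fin m → FinSeq) (sys : IsABSystem q (q + suc u) a b m xs ys) where

  xs′ ys′ : Fin m → FinSeq
  xs′ j = shiftDown u (xs j)
  ys′ j = shiftDown u (ys j)

  IsABSystem-shiftDown : IsABSystem (q ∸ suc u + 1) (q ∸ suc u + 2) a b m xs′ ys′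
  IsABSystem-shiftDown j with sys j
  ... | x≤q , y≤q , suppx≤a , suppy≤b , cap≡0 =
    InRange-shiftDown u (xs j) x≤q , InRange-shiftDown u (ys j) y≤q ,
    ≤-trans (suppSize-shiftDown u (xs j)) suppx≤a , ≤-trans (suppSize-shiftDown u (ys j)) suppy≤b ,
    trans (capSize-shiftDown u (xs j) (ys j) x≤q y≤q) cap≡0

  private
    capSize-shiftDown-≢0 : ∀ i j → capSize (q + suc u) (xs i) (ys j) ≢ 0 →
      capSize (q ∸ suc u + 2) (xs′ i) (ys′ j) ≢ 0
    capSize-shiftDown-≢0 i j cap≢0 = cap≢0 ∘ trans (sym (capSize-shiftDown u (xs i) (ys j) (proj₁ (sys i)) (proj₁ (proj₂ (sys j)))))

  IsStrong-shiftDown : IsStrong (q + suc u) m xs ys → IsStrong (q ∸ suc u + 2) m xs′ ys′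
  IsStrong-shiftDown strong i j i≢j = capSize-shiftDown-≢0 i j (strong i j i≢j)

  IsWeak-shiftDown : IsWeak (q + suc u) m xs ys → IsWeak (q ∸ suc u + 2) m xs′ ys′
  IsWeak-shiftDown weak i j i≢j =
    Sum.map (capSize-shiftDown-≢0 i j) (capSize-shiftDown-≢0 j i) (weak i j i≢j)

capSize≡0⇒sum< : ∀ {s} x y → 1 ≤ s → capSize s x y ≡ 0 → ∀ i → seq x i + seq y i < s
capSize≡0⇒sum< {s} x y 1≤s cap≡0 i with i <? bound x ⊔ bound y
... | yes i<bound = ≰⇒> λ s≤sum → subst T (countBelow≡0⇒false (bound x ⊔ bound y) cap≡0 i<bound) (≤⇒≤ᵇ s≤sum)
... | no  i≮bound
  rewrite vanish x i (m⊔n≤o⇒m≤o (bound x) (bound y) (≮⇒≥ i≮bound))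
        | vanish y i (m⊔n≤o⇒n≤o (bound x) (bound y) (≮⇒≥ i≮bound)) = 1≤s

IsABSystem⇒entries< : ∀ {q s a b m} (xs ys : Fin m → FinSeq) → 1 ≤ s → IsABSystem q s a b m xs ys →
  ∀ j i → seq (xs j) i < s × seq (ys j) i < s
IsABSystem⇒entries< xs ys 1≤s sys j i =
  ≤-<-trans (m≤m+n _ _) sum<s , ≤-<-trans (m≤n+m _ _) sum<s
  where sum<s = capSize≡0⇒sum< (xs j) (ys j) 1≤s (proj₂ (proj₂ (proj₂ (proj₂ (sys j))))) i

mainTheorem5 : (q a b : ℕ) → 1 ≤ q → 1 ≤ a → 1 ≤ b →
    ((s m : ℕ) → 1 ≤ s → (xs ys : Fin m → FinSeq) →
      IsABSystem q s a b m xs ys →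
      IsStrong s m xs ys ⊎ IsWeak s m xs ys →
      ∀ j i → seq (xs j) i < s × seq (ys j) i < s)
    ×
    ((t m : ℕ) → 1 < t → (xs ys : Fin m → FinSeq) →
      IsABSystem q (q + t) a b m xs ys →
      (IsStrong (q + t) m xs ys →
        ∃₂ λ (xs′ ys′ : Fin m → FinSeq) →
          IsABSystem ((q ∸ t) + 1) ((q ∸ t) + 2) a b m xs′ ys′
          × IsStrong ((q ∸ t) + 2) m xs′ ys′)
      ×
      (IsWeak (q + t) m xs ys →
        ∃₂ λ (xs′ ys′ : Fin m → FinSeq) →
          IsABSystem ((q ∸ t) + 1) ((q ∸ t) + 2) a b m xs′ ys′
          × IsWeak ((q ∸ t) + 2) m xs′ ys′))
mainTheorem5 q a b _ _ _ =
  (λ s m 1≤s xs ys sys _ → IsABSystem⇒entries< xs ys 1≤s sys) ,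
  -- the reduction works for every t ≥ 1; the hypothesis 1 < t only excludes t = 0
  λ { zero m () ; (suc u) m _ xs ys sys → let open ShiftDown {q} {a} {b} u xs ys sys in
        (λ strong → xs′ , ys′ , IsABSystem-shiftDown , IsStrong-shiftDown strong) ,
        (λ weak → xs′ , ys′ , IsABSystem-shiftDown , IsWeak-shiftDown weak) }
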